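{- Let $G$ be a graph and let $d$ be the length of a shortest maximal geodesic of $G$. Then ${\rm gpack}(G) \leq \lfloor n(G)/(d+1)\rfloor$.
   Context: $n(G)$ denotes the number of vertices of $G$. A geodesic is a shortest path; it is maximal if it is not contained as a subpath in any other geodesic; its length is its number of edges. A geodesic packing of $G$ is a set of pairwise vertex-disjoint maximal geodesics, and ${\rm gpack}(G)$ is the maximum cardinality of a geodesic packing. -}

module Defs where

open import Data.Nat using (ℕ; suc; _≤_; _∸_)
open import Data.Fin using (Fin)
open import Data.List using (List; []; _∷_; length; reverse)
open import Data.List.Membership.Propositional using (_∈_)
open import Data.List.Relation.Unary.AllPairs using (AllPairs)
open import Data.List.Relation.Binary.Infix.Heterogeneous using (Infix)
open import Data.Product using (Σ; _×_; ∃₂)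
open import Data.Sum using (_⊎_)
open import Data.Empty using (⊥)
open import Relation.Nullary using (¬_)
open import Relation.Binary.PropositionalEquality using (_≡_)

record Graph (n : ℕ) : Set₁ where
  field
    Adj   : Fin n → Fin n → Set
    sym   : ∀ {u v} → Adj u v → Adj v u
    irrefl : ∀ {u} → ¬ Adj u u

open Graph public

nV : ∀ {n} → Graph n → ℕ
nV {n} _ = n

data Walk {n : ℕ} (G : Graph n) : Fin n → Fin n → List (Fin n) → Set where
  stop : ∀ {u} → Walk G u u (u ∷ [])
  step : ∀ {u w v xs} → Adj G u w → Walk G w v xs → Walk G u v (u ∷ xs)

len : ∀ {n} → List (Fin n) → ℕ
len xs = length xs ∸ 1

IsGeodesic : ∀ {n} → Graph n → List (Fin n) → Set
IsGeodesic G P =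
  ∃₂ λ u v → Walk G u v P × (∀ Q → Walk G u v Q → len P ≤ len Q)

Subpath : ∀ {n} → List (Fin n) → List (Fin n) → Set
Subpath P Q = Infix _≡_ P Q ⊎ Infix _≡_ (reverse P) Q

-- P is a maximal geodesic: a geodesic not properly contained in any
-- other geodesic (any geodesic containing P has the same length)
IsMaximalGeodesic : ∀ {n} → Graph n → List (Fin n) → Set
IsMaximalGeodesic G P =
  IsGeodesic G P × (∀ Q → IsGeodesic G Q → Subpath P Q → len Q ≡ len P)

Disjoint : ∀ {n} → List (Fin n) → List (Fin n) → Set
Disjoint P Q = ∀ v → v ∈ P → v ∈ Q → ⊥

-- A geodesic packing: a collection of pairwise vertex-disjoint maximal
-- geodesics (given as a list; its cardinality is its length, distinctness
-- follows from disjointness since paths are nonempty).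
data AllMax {n} (G : Graph n) : List (List (Fin n)) → Set where
  []  : AllMax G []
  _∷_ : ∀ {P Ps} → IsMaximalGeodesic G P → AllMax G Ps → AllMax G (P ∷ Ps)

IsGeodesicPacking : ∀ {n} → Graph n → List (List (Fin n)) → Set
IsGeodesicPacking G Ps = AllMax G Ps × AllPairs Disjoint Ps

-- Every geodesic is a shortest walk, so its vertices are distinct, and every
-- maximal geodesic has at least d edges, hence at least d + 1 vertices.  The
-- geodesics of a packing are pairwise disjoint, so together they occupy at
-- least gpack(G) · (d + 1) distinct vertices, which is at most n(G).
module Submission where

open import Defs
open import Data.Nat using (ℕ; zero; suc; _+_; _*_; _≤_; z≤n; s≤s)
open import Data.Nat.Properties using (≤-trans; +-mono-≤)
open import Data.Nat.DivMod using (_/_; m*n/n≡m; /-monoˡ-≤)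
open import Data.List using (List; []; _∷_; _++_; length; concat; lookup)
open import Data.List.Properties using (length-++)
open import Data.Fin using (Fin; zero; suc)
open import Data.Fin.Properties using (injective⇒≤; _≟_)
open import Data.Product using (Σ; _×_; ∃-syntax; _,_; proj₁)
open import Data.Sum using (_⊎_; inj₁; inj₂)
open import Data.Empty using (⊥-elim)
open import Data.List.Membership.Propositional using (_∈_; _∉_)
open import Data.List.Membership.Propositional.Properties
  using (∈-++⁻; ∈-++⁺ˡ; ∈-++⁺ʳ; ∈-concat⁻; ∈-lookup)
open import Data.List.Relation.Binary.Subset.Propositional using (_⊆_)
open import Data.List.Relation.Unary.Any using (here; there)
open import Data.List.Relation.Unary.All as All using (All; []; _∷_)
open import Data.List.Relation.Unary.All.Properties using (¬Any⇒All¬)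
open import Data.List.Relation.Unary.AllPairs using (AllPairs; []; _∷_)
open import Data.List.Relation.Unary.Unique.Propositional using (Unique)
open import Data.List.Relation.Unary.Unique.Propositional.Properties using (++⁺)
open import Relation.Nullary using (yes; no)
open import Relation.Binary.PropositionalEquality using (_≡_; refl; cong; subst)
  renaming (sym to ≡-sym)

module _ {n : ℕ} {G : Graph n} where

  open import Data.List.Membership.DecPropositional (_≟_ {n}) using (_∈?_)

  walk-length≡suc-len : ∀ {u v xs} → Walk G u v xs → length xs ≡ suc (len xs)
  walk-length≡suc-len stop       = refl
  walk-length≡suc-len (step _ _) = refl

  walk-suffix : ∀ {u w v ys} → Walk G w v ys → Unique ys → u ∈ ys →
                ∃[ zs ] Walk G u v zs × Unique zs × zs ⊆ ys
  walk-suffix stop         uniq       (here refl) = _ , stop , uniq , λ z → z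
  walk-suffix W@(step _ _) uniq       (here refl) = _ , W , uniq , λ z → z
  walk-suffix (step _ W)   (_ ∷ uniq) (there u∈ys) =
    let zs , W′ , uniq′ , zs⊆ys = walk-suffix W uniq u∈ys
    in  zs , W′ , uniq′ , λ z → there (zs⊆ys z)

  -- Loops are cut out: if u reappears later on the walk, restart from there.
  walk⇒path : ∀ {u v xs} → Walk G u v xs →
              ∃[ ys ] Walk G u v ys × Unique ys × ys ⊆ xs
  walk⇒path stop = _ , stop , [] ∷ [] , λ z → z
  walk⇒path {u} (step u~w W) with walk⇒path W
  ... | ys , W′ , uniq , ys⊆xs with u ∈? ys
  ...   | yes u∈ys =
          let zs , W″ , uniq′ , zs⊆ys = walk-suffix W′ uniq u∈ys
          in  zs , W″ , uniq′ , λ z → there (ys⊆xs (zs⊆ys z))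
  ...   | no u∉ys =
          _ , step u~w W′ , ¬Any⇒All¬ ys u∉ys ∷ uniq ,
          λ { (here refl) → here refl ; (there z) → there (ys⊆xs z) }

  geodesic⇒path : ∀ {P} → IsGeodesic G P →
                  ∃[ ys ] Unique ys × ys ⊆ P × suc (len P) ≤ length ys
  geodesic⇒path {P} (u , v , W , shortest) =
    let ys , W′ , uniq , ys⊆P = walk⇒path W
    in  ys , uniq , ys⊆P ,
        subst (suc (len P) ≤_) (≡-sym (walk-length≡suc-len W′)) (s≤s (shortest ys W′))

lookup-injective : ∀ {a} {A : Set a} (xs : List A) → Unique xs →
                   ∀ i j → lookup xs i ≡ lookup xs j → i ≡ j
lookup-injective (_ ∷ _)  _          zero    zero    _  = refl
lookup-injective (_ ∷ _)  (x≢ ∷ _)   zero    (suc j) eq = ⊥-elim (All.lookup x≢ (∈-lookup j) eq)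
lookup-injective (_ ∷ _)  (x≢ ∷ _)   (suc i) zero    eq = ⊥-elim (All.lookup x≢ (∈-lookup i) (≡-sym eq))
lookup-injective (_ ∷ xs) (_ ∷ uniq) (suc i) (suc j) eq = cong suc (lookup-injective xs uniq i j eq)

unique-length≤ : ∀ {n} {xs : List (Fin n)} → Unique xs → length xs ≤ n
unique-length≤ {xs = xs} uniq = injective⇒≤ (λ {i} {j} → lookup-injective xs uniq i j)

disjoint-concat : ∀ {n} {P : List (Fin n)} {Ps v} →
                  All (Disjoint P) Ps → v ∈ P → v ∉ concat Ps
disjoint-concat {Ps = Ps} disjoint v∈P v∈Ps =
  let P#Q , v∈Q = All.lookupAny disjoint (∈-concat⁻ Ps v∈Ps)
  in  P#Q _ v∈P v∈Q

disjoint-union-length : ∀ {n} k (Ps : List (List (Fin n))) → AllPairs Disjoint Ps →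
  All (λ P → ∃[ ys ] Unique ys × ys ⊆ P × k ≤ length ys) Ps →
  ∃[ U ] Unique U × U ⊆ concat Ps × length Ps * k ≤ length U
disjoint-union-length k [] [] [] = [] , [] , (λ ()) , z≤n
disjoint-union-length k (P ∷ Ps) (P#Ps ∷ disjoint) ((ys , uniq , ys⊆P , k≤ys) ∷ picks)
  with disjoint-union-length k Ps disjoint picks
... | U , uniqU , U⊆Ps , bound =
  ys ++ U ,
  ++⁺ uniq uniqU (λ (y∈ys , y∈U) → disjoint-concat P#Ps (ys⊆P y∈ys) (U⊆Ps y∈U)) ,
  (λ z∈ → cover (∈-++⁻ ys z∈)) ,
  subst (k + length Ps * k ≤_) (≡-sym (length-++ ys)) (+-mono-≤ k≤ys bound)
  where
    cover : ∀ {z} → z ∈ ys ⊎ z ∈ U → z ∈ concat (P ∷ Ps)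
    cover (inj₁ z∈ys) = ∈-++⁺ˡ (ys⊆P z∈ys)
    cover (inj₂ z∈U)  = ∈-++⁺ʳ P (U⊆Ps z∈U)

AllMax⇒All : ∀ {n} {G : Graph n} {Ps} → AllMax G Ps → All (IsMaximalGeodesic G) Ps
AllMax⇒All []       = []
AllMax⇒All (m ∷ ms) = m ∷ AllMax⇒All ms

lemma2p3 : ∀ {n} (G : Graph n) (d : ℕ)
           → Σ (List (Fin n)) (λ P → IsMaximalGeodesic G P × len P ≡ d)
           → (∀ P → IsMaximalGeodesic G P → d ≤ len P)
           → ∀ (Ps : List (List (Fin n))) → IsGeodesicPacking G Ps
           → length Ps ≤ nV G / suc d
lemma2p3 {n} G d _ d≤len Ps (maximal , disjoint) =
  let U , uniq , _ , bound =
        disjoint-union-length (suc d) Ps disjoint (All.map long-path (AllMax⇒All maximal))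
  in  subst (_≤ n / suc d) (m*n/n≡m (length Ps) (suc d))
        (/-monoˡ-≤ (suc d) (≤-trans bound (unique-length≤ uniq)))
  where
    long-path : ∀ {P} → IsMaximalGeodesic G P →
                ∃[ ys ] Unique ys × ys ⊆ P × suc d ≤ length ys
    long-path {P} maxP =
      let ys , uniq , ys⊆P , len≤ = geodesic⇒path (proj₁ maxP)
      in  ys , uniq , ys⊆P , ≤-trans (s≤s (d≤len P maxP)) len≤
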